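{- Let $G$ be a graph with minimum degree at least $2$. For every path $Q$ of $G$, there exists an optimal lollipop of $G$ that contains all vertices of $Q$.
   Context: All graphs are finite and simple. A path is a sequence $p_1\dots p_s$ of distinct vertices with consecutive vertices adjacent; a cycle is a sequence $c_1\dots c_t c_1$ ($t\ge 3$) of distinct vertices with consecutive vertices (indices mod $t$) adjacent; its length is its number of edges. A lollipop in $G$ is a pair $L=(P,C)$ where $P=p_1\dots p_s$ ($s\geq 1$) is a path of $G$, $C=c_1\dots c_tc_1$ ($t\geq 3$) is a cycle of $G$, $p_s=c_1$ and $V(P)\cap V(C)=\{c_1\}$; $V(L)=V(P)\cup V(C)$. A lollipop $L=(P,C)$ is optimal if (1) no lollipop $L'$ of $G$ satisfies $V(L)\subsetneq V(L')$, and (2) no lollipop $L'=(P',C')$ of $G$ with $V(L')=V(L)$ has $C'$ longer than $C$. -}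

module Defs where

open import Data.Bool using (Bool; T)
open import Data.Nat using (ℕ; _≤_)
open import Data.Fin using (Fin)
open import Data.Fin.Properties using ()
open import Data.List using (List; []; _∷_; length; filterᵇ; allFin; last)
open import Data.List.Membership.Propositional using (_∈_)
open import Data.List.Relation.Unary.Unique.Propositional using (Unique)
open import Data.List.Relation.Unary.Linked using (Linked)
open import Data.Maybe using (Maybe; just)
open import Data.Product using (_×_; Σ; ∃)
open import Data.Sum using (_⊎_)
open import Relation.Binary.PropositionalEquality using (_≡_)
open import Relation.Nullary using (¬_)

record Graph (n : ℕ) : Set where
  field
    adj   : Fin n → Fin n → Bool
    sym   : ∀ u v → adj u v ≡ adj v u
    irrefl : ∀ v → adj v v ≡ Data.Bool.false

open Graph public

Adj : ∀ {n} → Graph n → Fin n → Fin n → Set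
Adj G u v = T (adj G u v)

degree : ∀ {n} → Graph n → Fin n → ℕ
degree {n} G v = length (filterᵇ (adj G v) (allFin n))

MinDegreeAtLeast : ∀ {n} → Graph n → ℕ → Set
MinDegreeAtLeast G k = ∀ v → k ≤ degree G v

record IsPath {n} (G : Graph n) (p : List (Fin n)) : Set where
  field
    nonempty : 1 ≤ length p
    distinct : Unique p
    linked   : Linked (Adj G) p

-- A cycle c₁ … cₜ c₁ (t ≥ 3), given by the list c₁ ∷ … ∷ cₜ.
record IsCycle {n} (G : Graph n) (c₁ : Fin n) (cs : List (Fin n)) : Set where
  field
    atLeast3 : 3 ≤ length (c₁ ∷ cs)
    distinct : Unique (c₁ ∷ cs)
    linked   : Linked (Adj G) (c₁ ∷ cs)
    closing  : ∀ {x} → last (c₁ ∷ cs) ≡ just x → Adj G x c₁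

record Lollipop {n} (G : Graph n) : Set where
  field
    P     : List (Fin n)
    c₁    : Fin n
    cs    : List (Fin n)
    isPath  : IsPath G P
    isCycle : IsCycle G c₁ cs
    joint   : last P ≡ just c₁
    meet    : ∀ x → x ∈ P → x ∈ (c₁ ∷ cs) → x ≡ c₁

  C : List (Fin n)
  C = c₁ ∷ cs

  -- length of the cycle = number of edges = t
  cycleLength : ℕ
  cycleLength = length C

open Lollipop public

_∈V_ : ∀ {n} {G : Graph n} → Fin n → Lollipop G → Set
x ∈V L = x ∈ P L ⊎ x ∈ C L

_⊆V_ : ∀ {n} {G : Graph n} → Lollipop G → Lollipop G → Set
L ⊆V L' = ∀ x → x ∈V L → x ∈V L'

_⊂V_ : ∀ {n} {G : Graph n} → Lollipop G → Lollipop G → Set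
L ⊂V L' = L ⊆V L' × ∃ λ x → x ∈V L' × ¬ (x ∈V L)

_≡V_ : ∀ {n} {G : Graph n} → Lollipop G → Lollipop G → Set
L ≡V L' = L ⊆V L' × L' ⊆V L

record Optimal {n} {G : Graph n} (L : Lollipop G) : Set where
  field
    maximal  : ∀ (L' : Lollipop G) → ¬ (L ⊂V L')
    longest  : ∀ (L' : Lollipop G) → L' ≡V L → cycleLength L' ≤ cycleLength L

-- Grow Q to a path S that is longest among the paths containing Q. Every
-- neighbour of the end vertex h of S lies on S, and since δ(G) ≥ 2 one of them,
-- u, is not the vertex following h. The segment of S from h to u closes into a
-- cycle through the edge hu, and the rest of S hangs off u as the stick: a
-- lollipop through all of Q. Among the lollipops through Q, take one maximising
-- (|V(L)|, length of C) lexicographically; a lollipop with a strictly larger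
-- vertex set, or with the same vertex set and a longer cycle, also contains Q
-- and has a larger key, so the maximiser is optimal. Both maxima range over
-- finite lists: lollipops are enumerated through their underlying vertex lists,
-- whose lengths are at most n.
module Submission where

open import Defs hiding (sym)
open import Level using (Level)
open import Data.Nat using (ℕ; zero; suc; _≤_; _<_; z≤n; s≤s; _≤?_)
open import Data.Nat.Properties
  using (≤-trans; ≤-refl; ≤-reflexive; <-irrefl; ≤-antisym; n≮0; ≤-decTotalOrder; ≤-totalOrder)
open import Data.Product.Relation.Binary.Lex.NonStrict using (×-totalOrder)
open import Data.Fin using (Fin; _≟_)
open import Data.Bool using (T)
open import Function using (id; _∘_)
open import Data.List
  using ( List; []; _∷_; _++_; [_]; length; head; last; reverse; _ʳ++_; filter; filterᵇ; allFin
        ; cartesianProductWith; cartesianProduct; concatMap)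
open import Data.List.Properties using (length-++-sucʳ; length-reverse; length-tabulate)
open import Data.List.Membership.Propositional using (_∈_; _∉_; lose)
open import Data.List.Membership.Propositional.Properties
  using ( ∈-∃++; ∈-++⁺ˡ; ∈-++⁺ʳ; ∈-++⁻; ∈-filter⁺; ∈-filter⁻; ∈-allFin
        ; ∈-cartesianProductWith⁺; ∈-cartesianProduct⁺; ∈-concatMap⁺)
open import Data.List.Relation.Binary.Subset.Propositional using (_⊆_)
open import Data.List.Relation.Binary.Disjoint.Propositional using (Disjoint)
open import Data.List.Relation.Unary.Any using (here; there)
open import Data.List.Relation.Unary.Any.Properties using (reverse⁺; reverse⁻)
open import Data.List.Relation.Unary.All as All using (All; _∷_)
open import Data.List.Relation.Unary.All.Properties using (all-filter)
open import Data.List.Relation.Unary.AllPairs using ([]; _∷_)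
open import Data.List.Relation.Unary.Unique.Propositional using (Unique)
open import Data.List.Relation.Unary.Unique.Propositional.Properties using (filter⁺; allFin⁺)
open import Data.List.Relation.Unary.Linked using (Linked; []; [-]; _∷_; linked?)
import Data.List.Extrema as Extrema
open import Data.Maybe using (Maybe; just; nothing)
open import Data.Maybe.Properties using (≡-dec)
open import Data.Maybe.Relation.Binary.Connected using (Connected; just; just-nothing; nothing-just; nothing; drop-just)
open import Data.Product using (Σ; ∃; ∃₂; _×_; _,_; proj₁; proj₂)
open import Data.Sum using (inj₁; inj₂)
open import Data.Empty using (⊥-elim)
open import Relation.Binary using (Rel; Symmetric; TotalOrder)
open import Relation.Unary using (Pred; Decidable)
open import Relation.Nullary using (¬_; Dec; yes; no)
open import Relation.Nullary.Decidable using (T?; map′; _×-dec_; _⊎-dec_; _→-dec_)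
open import Relation.Binary.PropositionalEquality using (_≡_; _≢_; refl; sym; subst; cong₂; setoid)

private
  variable
    a ℓ : Level

module _ {A : Set a} where

  Unique-++⁻ : ∀ xs {ys : List A} → Unique (xs ++ ys) → Unique xs × Unique ys × Disjoint xs ys
  Unique-++⁻ [] ys! = [] , ys! , λ { (() , _) }
  Unique-++⁻ (x ∷ xs) (x∉ ∷ xsys!) =
    let xs! , ys! , xs#ys = Unique-++⁻ xs xsys!
        x∉xs = All.tabulate λ y∈xs → All.lookup x∉ (∈-++⁺ˡ y∈xs)
        disjoint : Disjoint (x ∷ xs) _
        disjoint = λ { (here refl , v∈ys) → All.lookup x∉ (∈-++⁺ʳ xs v∈ys) refl
                     ; (there v∈xs , v∈ys) → xs#ys (v∈xs , v∈ys) }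
    in (x∉xs ∷ xs!) , ys! , disjoint

  Unique⇒length≤ : ∀ {xs ys : List A} → Unique xs → xs ⊆ ys → length xs ≤ length ys
  Unique⇒length≤ {[]} _ _ = z≤n
  Unique⇒length≤ {x ∷ xs} (x∉xs ∷ xs!) xs⊆ys with ys₁ , ys₂ , refl ← ∈-∃++ (xs⊆ys (here refl)) =
    ≤-trans (s≤s (Unique⇒length≤ xs! xs⊆ys₁ys₂)) (≤-reflexive (sym (length-++-sucʳ ys₁ x ys₂)))
    where
      xs⊆ys₁ys₂ : xs ⊆ ys₁ ++ ys₂
      xs⊆ys₁ys₂ y∈xs with ∈-++⁻ ys₁ (xs⊆ys (there y∈xs))
      ... | inj₁ y∈ys₁ = ∈-++⁺ˡ y∈ys₁
      ... | inj₂ (here refl) = ⊥-elim (All.lookup x∉xs y∈xs refl)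
      ... | inj₂ (there y∈ys₂) = ∈-++⁺ʳ ys₁ y∈ys₂

  Unique-reverse : ∀ {xs : List A} → Unique xs → Unique (reverse xs)
  Unique-reverse {xs} = Unique-resp-↭ (↭-sym (↭-reverse xs))
    where
      open import Data.List.Relation.Binary.Permutation.Setoid.Properties (setoid A)
        using (Unique-resp-↭; ↭-reverse)
      open import Data.List.Relation.Binary.Permutation.Setoid (setoid A) using (↭-sym)

  two-distinct : ∀ {xs : List A} → 2 ≤ length xs → Unique xs → ∃₂ λ a b → a ∈ xs × b ∈ xs × a ≢ b
  two-distinct {_ ∷ []} (s≤s ()) _
  two-distinct {a ∷ b ∷ _} _ ((a≢b ∷ _) ∷ _) = a , b , here refl , there (here refl) , a≢b

  last-ʳ++ : ∀ xs {x : A} {acc} → last (xs ʳ++ x ∷ acc) ≡ last (x ∷ acc)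
  last-ʳ++ [] = refl
  last-ʳ++ (y ∷ xs) = last-ʳ++ xs

  last-reverse : ∀ (x : A) xs → last (reverse (x ∷ xs)) ≡ just x
  last-reverse x xs = last-ʳ++ xs

  listsOfLength≤ : List A → ℕ → List (List A)
  listsOfLength≤ as zero = [ [] ]
  listsOfLength≤ as (suc k) = [] ∷ cartesianProductWith _∷_ as (listsOfLength≤ as k)

  ∈-listsOfLength≤ : ∀ {as xs : List A} k → xs ⊆ as → length xs ≤ k → xs ∈ listsOfLength≤ as k
  ∈-listsOfLength≤ {xs = []} zero _ _ = here refl
  ∈-listsOfLength≤ {xs = []} (suc k) _ _ = here refl
  ∈-listsOfLength≤ {xs = x ∷ xs} (suc k) xs⊆as (s≤s |xs|≤k) =
    there (∈-cartesianProductWith⁺ _∷_ (xs⊆as (here refl)) (∈-listsOfLength≤ k (xs⊆as ∘ there) |xs|≤k))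

module _ {A : Set a} {R : Rel A ℓ} where

  Linked-++⁻ : ∀ xs {ys} → Linked R (xs ++ ys) → Linked R xs × Connected R (last xs) (head ys) × Linked R ys
  Linked-++⁻ [] {[]} [] = [] , nothing , []
  Linked-++⁻ [] {y ∷ ys} Rys = [] , nothing-just , Rys
  Linked-++⁻ (x ∷ []) {[]} [-] = [-] , just-nothing , []
  Linked-++⁻ (x ∷ []) {y ∷ ys} (Rxy ∷ Rys) = [-] , just Rxy , Rys
  Linked-++⁻ (x ∷ y ∷ xs) (Rxy ∷ Ryxsys) =
    let Ryxs , Rlast , Rys = Linked-++⁻ (y ∷ xs) Ryxsys in (Rxy ∷ Ryxs) , Rlast , Rys

  Linked-reverse : Symmetric R → ∀ {xs} → Linked R xs → Linked R (reverse xs)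
  Linked-reverse R-sym [] = []
  Linked-reverse R-sym {x ∷ xs} Rxxs = go [-] Rxxs
    where
      go : ∀ {x acc xs} → Linked R (x ∷ acc) → Linked R (x ∷ xs) → Linked R (xs ʳ++ x ∷ acc)
      go Racc [-] = Racc
      go Racc (Rxy ∷ Rys) = go (R-sym Rxy ∷ Racc) Rys

module _ {o ℓ₁ ℓ₂ p} (O : TotalOrder o ℓ₁ ℓ₂) {A : Set a}
         (f : A → TotalOrder.Carrier O) {P : Pred A p} (P? : Decidable P) where

  open TotalOrder O renaming (_≤_ to _≼_)
  open Extrema O using (argmax; argmax-all; f[xs]≤f[argmax])

  argmax-filter : ∀ x₀ → P x₀ → (xs : List A) →
                  ∃ λ m → P m × (∀ {y} → y ∈ xs → P y → f y ≼ f m)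
  argmax-filter x₀ Px₀ xs =
    argmax f x₀ (filter P? xs) ,
    argmax-all f Px₀ (all-filter P? xs) ,
    λ y∈xs Py → All.lookup (f[xs]≤f[argmax] {f = f} x₀ (filter P? xs)) (∈-filter⁺ P? y∈xs Py)

ℕ×ℕ-lex : TotalOrder _ _ _
ℕ×ℕ-lex = ×-totalOrder ≤-decTotalOrder ≤-totalOrder

open TotalOrder ℕ×ℕ-lex using () renaming (_≤_ to _≤ₗₑₓ_)

module _ {x₁ y₁ x₂ y₂ : ℕ} where

  ≤ₗₑₓ⇒≤₁ : (x₁ , y₁) ≤ₗₑₓ (x₂ , y₂) → x₁ ≤ x₂
  ≤ₗₑₓ⇒≤₁ (inj₁ (x₁≤x₂ , _)) = x₁≤x₂
  ≤ₗₑₓ⇒≤₁ (inj₂ (refl , _)) = ≤-refl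

  ≤ₗₑₓ⇒≤₂ : x₁ ≡ x₂ → (x₁ , y₁) ≤ₗₑₓ (x₂ , y₂) → y₁ ≤ y₂
  ≤ₗₑₓ⇒≤₂ x₁≡x₂ (inj₁ (_ , x₁≢x₂)) = ⊥-elim (x₁≢x₂ x₁≡x₂)
  ≤ₗₑₓ⇒≤₂ _ (inj₂ (_ , y₁≤y₂)) = y₁≤y₂

module _ {n : ℕ} (G : Graph n) where

  open import Data.List.Relation.Unary.Unique.DecPropositional (_≟_ {n}) using (unique?)
  open import Data.List.Membership.DecPropositional (_≟_ {n}) using (_∈?_)
  open import Data.List.Relation.Binary.Subset.DecPropositional (_≟_ {n}) using (_⊆?_)

  private
    V : Set
    V = Fin n

    _~_ : Rel V _
    _~_ = Adj G

  ~-sym : Symmetric _~_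
  ~-sym {u} {v} = subst T (Graph.sym G u v)

  ~-irrefl : ∀ {v} → ¬ v ~ v
  ~-irrefl {v} = subst T (Graph.irrefl G v)

  Unique⇒length≤n : ∀ {xs : List V} → Unique xs → length xs ≤ n
  Unique⇒length≤n {xs} xs! =
    subst (length xs ≤_) (length-tabulate id) (Unique⇒length≤ xs! (λ {x} _ → ∈-allFin x))

  IsPath-reverse : ∀ {p} → IsPath G p → IsPath G (reverse p)
  IsPath-reverse {p} p-path = record
    { nonempty = subst (1 ≤_) (sym (length-reverse p)) (IsPath.nonempty p-path)
    ; distinct = Unique-reverse (IsPath.distinct p-path)
    ; linked   = Linked-reverse ~-sym (IsPath.linked p-path)
    }

  IsPath-∷⁺ : ∀ {w h T} → IsPath G (h ∷ T) → h ~ w → w ∉ h ∷ T → IsPath G (w ∷ h ∷ T)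
  IsPath-∷⁺ p-path h~w w∉p = record
    { nonempty = s≤s z≤n
    ; distinct = All.tabulate (λ v∈p w≡v → w∉p (subst (_∈ _) (sym w≡v) v∈p)) ∷ IsPath.distinct p-path
    ; linked   = ~-sym h~w ∷ IsPath.linked p-path
    }

  adj? : ∀ u v → Dec (u ~ v)
  adj? u v = T? (adj G u v)

  isPath? : ∀ p → Dec (IsPath G p)
  isPath? p = map′ (λ (ne , p! , p~) → record { nonempty = ne ; distinct = p! ; linked = p~ })
                   (λ p-path → IsPath.nonempty p-path , IsPath.distinct p-path , IsPath.linked p-path)
                   ((1 ≤? length p) ×-dec unique? p ×-dec linked? adj? p)

  Closes : V → Maybe V → Set
  Closes c m = ∀ {x} → m ≡ just x → x ~ c

  closes? : ∀ c m → Dec (Closes c m)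
  closes? c nothing = yes λ ()
  closes? c (just y) = map′ (λ y~c → λ { refl → y~c }) (λ closes → closes refl) (adj? y c)

  isCycle? : ∀ c cs → Dec (IsCycle G c cs)
  isCycle? c cs =
    map′ toCycle
         (λ c-cycle → IsCycle.atLeast3 c-cycle , IsCycle.distinct c-cycle ,
                      IsCycle.linked c-cycle , IsCycle.closing c-cycle)
         ((3 ≤? length (c ∷ cs)) ×-dec unique? (c ∷ cs) ×-dec
          linked? adj? (c ∷ cs) ×-dec closes? c (last (c ∷ cs)))
    where
      toCycle : 3 ≤ length (c ∷ cs) × Unique (c ∷ cs) × Linked _~_ (c ∷ cs) × Closes c (last (c ∷ cs)) →
                IsCycle G c cs
      toCycle (t≥3 , c! , c~ , cl) = record { atLeast3 = t≥3 ; distinct = c! ; linked = c~ ; closing = cl }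

  neighbours : V → List V
  neighbours v = filterᵇ (adj G v) (allFin n)

  ∈-neighbours⁻ : ∀ {u v} → u ∈ neighbours v → v ~ u
  ∈-neighbours⁻ {v = v} u∈N = proj₂ (∈-filter⁻ (T? ∘ adj G v) {xs = allFin n} u∈N)

  ∈-neighbours⁺ : ∀ {u v} → v ~ u → u ∈ neighbours v
  ∈-neighbours⁺ {u} {v} v~u = ∈-filter⁺ (T? ∘ adj G v) (∈-allFin u) v~u

  neighbour-≢ : MinDegreeAtLeast G 2 → ∀ v r → ∃ λ u → v ~ u × u ≢ r
  neighbour-≢ δ≥2 v r
    with a , b , a∈N , b∈N , a≢b ← two-distinct (δ≥2 v) (filter⁺ (T? ∘ adj G v) (allFin⁺ n))
    with a ≟ r
  ... | no a≢r = a , ∈-neighbours⁻ a∈N , a≢r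
  ... | yes refl = b , ∈-neighbours⁻ b∈N , a≢b ∘ sym

  lists≤n : List (List V)
  lists≤n = listsOfLength≤ (allFin n) n

  ∈-lists≤n : ∀ {xs} → Unique xs → xs ∈ lists≤n
  ∈-lists≤n xs! = ∈-listsOfLength≤ n (λ {x} _ → ∈-allFin x) (Unique⇒length≤n xs!)

  longest⇒inextensible : ∀ {Q h T} → IsPath G (h ∷ T) → Q ⊆ h ∷ T →
    (∀ {S} → S ∈ lists≤n → IsPath G S × Q ⊆ S → length S ≤ length (h ∷ T)) →
    neighbours h ⊆ h ∷ T
  longest⇒inextensible {h = h} {T} p-path Q⊆p longest {w} w∈N with w ∈? h ∷ T
  ... | yes w∈p = w∈p
  ... | no w∉p = ⊥-elim (<-irrefl refl (longest (∈-lists≤n (IsPath.distinct wp-path)) (wp-path , there ∘ Q⊆p)))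
    where
      wp-path : IsPath G (w ∷ h ∷ T)
      wp-path = IsPath-∷⁺ p-path (∈-neighbours⁻ w∈N) w∉p

  ∃-inextensible-path-⊇ : ∀ {Q} → IsPath G Q →
                          ∃₂ λ h T → IsPath G (h ∷ T) × Q ⊆ h ∷ T × neighbours h ⊆ h ∷ T
  ∃-inextensible-path-⊇ {Q} Q-path
    with argmax-filter ≤-totalOrder length (λ S → isPath? S ×-dec Q ⊆? S) Q (Q-path , id) lists≤n
  ... | [] , (p-path , _) , _ = ⊥-elim (n≮0 (IsPath.nonempty p-path))
  ... | h ∷ T , (p-path , Q⊆p) , longest = h , T , p-path , Q⊆p , longest⇒inextensible p-path Q⊆p longest

  Covers : List V → Lollipop G → Set
  Covers Q L = ∀ x → x ∈ Q → x ∈V L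

  chord-lollipop : ∀ {h r X u Y} → IsPath G (h ∷ r ∷ X ++ u ∷ Y) → h ~ u →
                   Σ (Lollipop G) (Covers (h ∷ r ∷ X ++ u ∷ Y))
  chord-lollipop {h} {r} {X} {u} {Y} p-path h~u
    with arc! , uY! , arc#uY ← Unique-++⁻ (h ∷ r ∷ X) (IsPath.distinct p-path)
       | arc~ , arc→u , uY~ ← Linked-++⁻ (h ∷ r ∷ X) (IsPath.linked p-path) = L , covers
    where
      arc : List V
      arc = h ∷ r ∷ X

      cycle : IsCycle G u arc
      cycle = record
        { atLeast3 = s≤s (s≤s (s≤s z≤n))
        ; distinct = All.tabulate (λ v∈arc u≡v → arc#uY (v∈arc , here (sym u≡v))) ∷ arc!
        ; linked   = ~-sym h~u ∷ arc~
        ; closing  = λ last≡x → drop-just (subst (λ m → Connected _~_ m (just u)) last≡x arc→u)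
        }

      stick : IsPath G (reverse (u ∷ Y))
      stick = IsPath-reverse (record { nonempty = s≤s z≤n ; distinct = uY! ; linked = uY~ })

      meets : ∀ x → x ∈ reverse (u ∷ Y) → x ∈ u ∷ arc → x ≡ u
      meets x _ (here x≡u) = x≡u
      meets x x∈P (there x∈arc) = ⊥-elim (arc#uY (x∈arc , reverse⁻ x∈P))

      L : Lollipop G
      L = record { P = reverse (u ∷ Y) ; c₁ = u ; cs = arc ; isPath = stick
                 ; isCycle = cycle ; joint = last-reverse u Y ; meet = meets }

      covers : Covers (arc ++ u ∷ Y) L
      covers x x∈p with ∈-++⁻ arc x∈p
      ... | inj₁ x∈arc = inj₂ (there x∈arc)
      ... | inj₂ x∈uY = inj₁ (reverse⁺ x∈uY)

  inextensible-path-lollipop : MinDegreeAtLeast G 2 → ∀ {h T} → IsPath G (h ∷ T) → neighbours h ⊆ h ∷ T →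
                        Σ (Lollipop G) (Covers (h ∷ T))
  inextensible-path-lollipop δ≥2 {h} {[]} _ N⊆p
    with u , h~u , u≢h ← neighbour-≢ δ≥2 h h
    with here u≡h ← N⊆p (∈-neighbours⁺ h~u) = ⊥-elim (u≢h u≡h)
  inextensible-path-lollipop δ≥2 {h} {r ∷ T} p-path N⊆p
    with u , h~u , u≢r ← neighbour-≢ δ≥2 h r
    with N⊆p (∈-neighbours⁺ h~u)
  ... | here u≡h = ⊥-elim (~-irrefl (subst (h ~_) u≡h h~u))
  ... | there (here u≡r) = ⊥-elim (u≢r u≡r)
  ... | there (there u∈T) with X , Y , refl ← ∈-∃++ u∈T = chord-lollipop p-path h~u

  _∈V?_ : ∀ x (L : Lollipop G) → Dec (x ∈V L)
  x ∈V? L = (x ∈? P L) ⊎-dec (x ∈? C L)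

  covers? : ∀ Q L → Dec (Covers Q L)
  covers? Q L = map′ (λ all x → All.lookup all) (λ covers → All.tabulate (covers _)) (All.all? (_∈V? L) Q)

  vertices : Lollipop G → List V
  vertices L = filter (_∈V? L) (allFin n)

  size : Lollipop G → ℕ
  size L = length (vertices L)

  vertices! : ∀ L → Unique (vertices L)
  vertices! L = filter⁺ (_∈V? L) (allFin⁺ n)

  ∈-vertices⁺ : ∀ L {x} → x ∈V L → x ∈ vertices L
  ∈-vertices⁺ L {x} = ∈-filter⁺ (_∈V? L) (∈-allFin x)

  ∈-vertices⁻ : ∀ L {x} → x ∈ vertices L → x ∈V L
  ∈-vertices⁻ L = proj₂ ∘ ∈-filter⁻ (_∈V? L) {xs = allFin n}

  size-mono : ∀ L L' → L ⊆V L' → size L ≤ size L'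
  size-mono L L' L⊆L' = Unique⇒length≤ (vertices! L) (∈-vertices⁺ L' ∘ L⊆L' _ ∘ ∈-vertices⁻ L)

  size-cong : ∀ L L' → L ≡V L' → size L ≡ size L'
  size-cong L L' (L⊆L' , L'⊆L) = ≤-antisym (size-mono L L' L⊆L') (size-mono L' L L'⊆L)

  size-strict : ∀ L L' → L ⊂V L' → size L < size L'
  size-strict L L' (L⊆L' , x , x∈L' , x∉L) =
    Unique⇒length≤ (x∉L′ ∷ vertices! L) x∷L⊆L'
    where
      x∉L′ : All (x ≢_) (vertices L)
      x∉L′ = All.tabulate λ y∈L x≡y → x∉L (subst (_∈V L) (sym x≡y) (∈-vertices⁻ L y∈L))

      x∷L⊆L' : x ∷ vertices L ⊆ vertices L'
      x∷L⊆L' (here refl) = ∈-vertices⁺ L' x∈L'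
      x∷L⊆L' (there y∈L) = ∈-vertices⁺ L' (L⊆L' _ (∈-vertices⁻ L y∈L))

  IsLollipop : List V → V → List V → Set
  IsLollipop p c cs = IsPath G p × IsCycle G c cs × last p ≡ just c × (∀ x → x ∈ p → x ∈ c ∷ cs → x ≡ c)

  isLollipop? : ∀ p c cs → Dec (IsLollipop p c cs)
  isLollipop? p c cs = isPath? p ×-dec isCycle? c cs ×-dec ≡-dec _≟_ (last p) (just c) ×-dec meets?
    where
      meets? : Dec (∀ x → x ∈ p → x ∈ c ∷ cs → x ≡ c)
      meets? = map′ (λ all x → All.lookup all) (λ meets → All.tabulate (meets _))
                    (All.all? (λ x → (x ∈? c ∷ cs) →-dec (x ≟ c)) p)

  candidates : List V × V × List V → List (Lollipop G)
  candidates (p , c , cs) with isLollipop? p c cs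
  ... | yes (p-path , c-cycle , p→c , p∩c) =
    [ record { P = p ; c₁ = c ; cs = cs ; isPath = p-path ; isCycle = c-cycle ; joint = p→c ; meet = p∩c } ]
  ... | no _ = []

  lollipops : List (Lollipop G)
  lollipops = concatMap candidates (cartesianProduct lists≤n (cartesianProduct (allFin n) lists≤n))

  candidates-complete : ∀ L → ∃ λ L' → L' ∈ candidates (P L , c₁ L , cs L) ×
                                       L' ≡V L × cycleLength L' ≡ cycleLength L
  candidates-complete L with isLollipop? (P L) (c₁ L) (cs L)
  ... | yes _ = _ , here refl , ((λ _ → id) , (λ _ → id)) , refl
  ... | no ¬L = ⊥-elim (¬L (isPath L , isCycle L , joint L , meet L))

  lollipops-complete : ∀ L → ∃ λ L' → L' ∈ lollipops × L' ≡V L × cycleLength L' ≡ cycleLength L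
  lollipops-complete L with L' , L'∈ , L'≡L , |C'|≡|C| ← candidates-complete L =
    L' , ∈-concatMap⁺ candidates (lose L∈triples L'∈) , L'≡L , |C'|≡|C|
    where
      cs! : Unique (cs L)
      cs! with _ ∷ cs! ← IsCycle.distinct (isCycle L) = cs!

      L∈triples : (P L , c₁ L , cs L) ∈ cartesianProduct lists≤n (cartesianProduct (allFin n) lists≤n)
      L∈triples = ∈-cartesianProduct⁺ (∈-lists≤n (IsPath.distinct (isPath L)))
                    (∈-cartesianProduct⁺ (∈-allFin (c₁ L)) (∈-lists≤n cs!))

  key : Lollipop G → ℕ × ℕ
  key L = size L , cycleLength L

  optimal-if-key-maximal : ∀ {Q L} → Covers Q L →
    (∀ {L'} → L' ∈ lollipops → Covers Q L' → key L' ≤ₗₑₓ key L) → Optimal L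
  optimal-if-key-maximal {L = L} Q⊆L key-max = record { maximal = maximal ; longest = longest }
    where
      key-max′ : ∀ L' → L ⊆V L' → key L' ≤ₗₑₓ key L
      key-max′ L' L⊆L' with L'' , L''∈ , L''≡L' , |C''|≡|C'| ← lollipops-complete L' =
        subst (_≤ₗₑₓ key L) (cong₂ _,_ (size-cong L'' L' L''≡L') |C''|≡|C'|)
              (key-max L''∈ λ x x∈Q → proj₂ L''≡L' x (L⊆L' x (Q⊆L x x∈Q)))

      maximal : ∀ L' → ¬ (L ⊂V L')
      maximal L' L⊂L' =
        <-irrefl refl (≤-trans (size-strict L L' L⊂L') (≤ₗₑₓ⇒≤₁ (key-max′ L' (proj₁ L⊂L'))))

      longest : ∀ L' → L' ≡V L → cycleLength L' ≤ cycleLength L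
      longest L' (L'⊆L , L⊆L') = ≤ₗₑₓ⇒≤₂ (size-cong L' L (L'⊆L , L⊆L')) (key-max′ L' L⊆L')

lemma1 : ∀ {n} (G : Graph n) → MinDegreeAtLeast G 2 →
    ∀ (Q : List (Fin n)) → IsPath G Q →
    Σ (Lollipop G) λ L → Optimal L × (∀ x → x ∈ Q → x ∈V L)
lemma1 G δ≥2 Q Q-path =
  let _ , _ , S-path , Q⊆S , S-inextensible = ∃-inextensible-path-⊇ G Q-path
      L₀ , S⊆L₀ = inextensible-path-lollipop G δ≥2 S-path S-inextensible
      L , Q⊆L , key-max =
        argmax-filter ℕ×ℕ-lex (key G) (covers? G Q) L₀ (λ x → S⊆L₀ x ∘ Q⊆S) (lollipops G)
  in L , optimal-if-key-maximal G Q⊆L key-max , Q⊆L
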